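{- Let $f:\{0,1\}^n\to\{0,1\}$ be monotone and let $x^{\star}\in\{0,1\}^n$ satisfy $f(x^{\star})=1$. If Algorithm CERT (described in the context), run on $f$ and $x^{\star}$, terminates, then its output $A$ is a minimal certificate for $f$ at $x^{\star}$.
   Context: For $S\subseteq[n]$, $x_S\in\{0,1\}^n$ denotes the indicator vector of $S$ and $x|_S$ the restriction of $x$ to coordinates in $S$; $S_{x}=\{i:x_i=1\}$; $[s]=\{1,\dots,s\}$ and $[0]=\emptyset$. $f$ is monotone if $x\le y$ coordinatewise implies $f(x)\le f(y)$. A set $S\subseteq[n]$ is a certificate for $f$ at $x$ if every $y$ with $y|_S=x|_S$ satisfies $f(y)=f(x)$; it is minimal if for every $a\in S$, $S\setminus\{a\}$ is not a certificate. The procedure $\mathsf{search}(f,A,S)$, for $A,S\subseteq[n]$: if $f(x_A)=1$ or $f(x_{A\cup S})=0$ it outputs $\mathsf{ERROR}$; otherwise it outputs the smallest $s\in S$ with $f(x_{A\cup([s]\cap S)})=1$, found by binary search over $S$. Algorithm CERT: initialize $A\gets\emptyset$, $S\gets S_{x^{\star}}$; while $f(x_A)\ne 1$, do: $s\gets\mathsf{search}(f,A,S)$; $A\gets A\cup\{s\}$; $S\gets S\cap[s-1]$. When $f(x_A)=1$, output $A$. -}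

module Defs where

open import Data.Nat using (ℕ; zero; suc)
open import Data.Bool using (Bool; true; false; _∧_; _∨_; not; if_then_else_; T)
open import Data.Bool using () renaming (_≤_ to _≤𝔹_)
open import Data.Fin using (Fin; toℕ)
open import Data.Fin.Properties using (_≟_)
open import Data.Nat using (_<ᵇ_; _≤ᵇ_)
open import Data.List using (List; []; _∷_; allFin)
open import Data.Maybe using (Maybe; just; nothing)
open import Relation.Nullary using (¬_; ⌊_⌋)
open import Data.Product using (_×_; Σ)
open import Relation.Binary.PropositionalEquality using (_≡_)

-- Points of {0,1}^n and subsets of [n] are both represented as Fin n → Bool;
-- a subset S is identified with its indicator vector x_S.
-- Coordinates Fin n are ordered by toℕ (Fin index i corresponds to element i+1 of [n]).
Point : ℕ → Set
Point n = Fin n → Bool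

BoolFun : ℕ → Set
BoolFun n = Point n → Bool

_≤ₚ_ : ∀ {n} → Point n → Point n → Set
x ≤ₚ y = ∀ i → x i ≤𝔹 y i

Monotone : ∀ {n} → BoolFun n → Set
Monotone {n} f = ∀ (x y : Point n) → x ≤ₚ y → f x ≤𝔹 f y

IsCertificate : ∀ {n} → BoolFun n → Point n → (S : Point n) → Set
IsCertificate {n} f x S = ∀ (y : Point n) → (∀ i → T (S i) → y i ≡ x i) → f y ≡ f x

remove : ∀ {n} → Point n → Fin n → Point n
remove S a i = S i ∧ not ⌊ i ≟ a ⌋

IsMinimalCertificate : ∀ {n} → BoolFun n → Point n → (S : Point n) → Set
IsMinimalCertificate f x S =
  IsCertificate f x S × (∀ a → T (S a) → ¬ IsCertificate f x (remove S a))

∅ : ∀ {n} → Point n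
∅ _ = false

_∪_ : ∀ {n} → Point n → Point n → Point n
(A ∪ B) i = A i ∨ B i

singleton : ∀ {n} → Fin n → Point n
singleton a i = ⌊ i ≟ a ⌋

upToIn : ∀ {n} → Fin n → Point n → Point n
upToIn s S i = S i ∧ (toℕ i ≤ᵇ toℕ s)

belowIn : ∀ {n} → Fin n → Point n → Point n
belowIn s S i = S i ∧ (toℕ i <ᵇ toℕ s)

firstSuch : ∀ {n} → (Fin n → Bool) → List (Fin n) → Maybe (Fin n)
firstSuch p [] = nothing
firstSuch p (i ∷ is) = if p i then just i else firstSuch p is

-- search(f, A, S): nothing = ERROR; otherwise the smallest s ∈ S with
-- f(x_{A ∪ ([s] ∩ S)}) = 1 (specified by its output, which is what binary search returns).
search : ∀ {n} → BoolFun n → Point n → Point n → Maybe (Fin n)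
search {n} f A S =
  if f A then nothing
  else if not (f (A ∪ S)) then nothing
  else firstSuch (λ s → S s ∧ f (A ∪ upToIn s S)) (allFin n)

-- The main loop of CERT run for at most `fuel` iterations.
-- Returns just A if the loop exits (f(x_A) = 1) within the fuel, nothing
-- if search outputs ERROR or the fuel runs out.
certLoop : ∀ {n} → BoolFun n → ℕ → Point n → Point n → Maybe (Point n)
certLoop f fuel A S with f A
... | true = just A
certLoop f zero A S | false = nothing
certLoop f (suc k) A S | false with search f A S
... | nothing = nothing
... | just s = certLoop f k (A ∪ singleton s) (belowIn s S)

CertOutputs : ∀ {n} → BoolFun n → Point n → Point n → Set
CertOutputs f xstar A = Σ ℕ (λ fuel → certLoop f fuel ∅ xstar ≡ just A)

{-# OPTIONS --safe #-}
module Submission where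

-- The loop maintains A ⊆ x⋆, S ⊆ x⋆ and, for every a ∈ A, f(x_{(A ∖ {a}) ∪ S}) = 0.
-- The new element s is in S, and f(x_{A ∪ (S ∩ [s-1])}) = 0 because that set is A or
-- A ∪ ([j] ∩ S) for some j ∈ S below s, which search rejected; so the invariant
-- survives adding s to A and cutting S down to S ∩ [s-1]. On exit f(x_A) = 1, and
-- monotonicity makes A a certificate, while the invariant gives f(x_{A ∖ {a}}) = 0
-- for each a ∈ A, so the point x_{A ∖ {a}} itself shows A ∖ {a} is no certificate.

open import Defs
open import Data.Nat using (ℕ; zero; suc; _<_; _≤_; _<ᵇ_; s≤s; z≤n)
open import Data.Nat.Properties
  using ( <ᵇ⇒<; <⇒<ᵇ; ≤⇒≤ᵇ; <⇒≤; ≤-reflexive; <-irrefl; <-trans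
        ; m<n⇒m<1+n; m<1+n⇒m≤n; m<1+n⇒m<n∨m≡n)
open import Data.Bool using (Bool; true; false; _∧_; T)
open import Data.Bool using () renaming (_≤_ to _≤𝔹_)
open import Data.Bool.Base using (b≤b; f≤t)
open import Data.Bool.Properties using (T-≡; T-∧; T-∨; ≤-antisym; ≤-minimum; ≤-maximum)
open import Data.Fin using (Fin; toℕ; fromℕ<; zero; suc)
open import Data.Fin.Properties using (toℕ-fromℕ<; toℕ-injective; toℕ<n)
open import Data.Empty using (⊥-elim)
open import Data.Sum using (_⊎_; inj₁; inj₂)
open import Data.Product using (∃; _×_; _,_; proj₁; proj₂)
open import Data.Maybe using (just)
open import Data.List using (tabulate; allFin)
open import Function using (_∘_)
open import Function.Bundles using (Equivalence)
open import Relation.Nullary using (¬_; yes; no)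
open import Relation.Nullary.Decidable using (T?; toWitness; toWitnessFalse; fromWitnessFalse)
open import Relation.Binary.PropositionalEquality using (_≡_; _≢_; refl; sym; trans; subst)

open Equivalence using (to; from)

infix 4 _⊆_

_⊆_ : ∀ {n} → Point n → Point n → Set
A ⊆ B = ∀ i → T (A i) → T (B i)

module _ {n : ℕ} where

  ⊆-refl : {A : Point n} → A ⊆ A
  ⊆-refl _ i∈A = i∈A

  ⊆-trans : {A B C : Point n} → A ⊆ B → B ⊆ C → A ⊆ C
  ⊆-trans A⊆B B⊆C i = B⊆C i ∘ A⊆B i

  ⊆-∪ˡ : {A B : Point n} → A ⊆ A ∪ B
  ⊆-∪ˡ {A} i = from (T-∨ {A i}) ∘ inj₁

  ⊆-∪ʳ : {A B : Point n} → B ⊆ A ∪ B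
  ⊆-∪ʳ {A} i = from (T-∨ {A i}) ∘ inj₂

  ∪-⊆ : {A B C : Point n} → A ⊆ C → B ⊆ C → A ∪ B ⊆ C
  ∪-⊆ {A} A⊆C B⊆C i t with to (T-∨ {A i}) t
  ... | inj₁ a = A⊆C i a
  ... | inj₂ b = B⊆C i b

  ∪-mono-⊆ : {A B C D : Point n} → A ⊆ C → B ⊆ D → A ∪ B ⊆ C ∪ D
  ∪-mono-⊆ A⊆C B⊆D = ∪-⊆ (⊆-trans A⊆C ⊆-∪ˡ) (⊆-trans B⊆D ⊆-∪ʳ)

  ∈-singleton : {s i : Fin n} → T (singleton s i) → i ≡ s
  ∈-singleton = toWitness

  singleton-⊆ : {B : Point n} {s : Fin n} → T (B s) → singleton s ⊆ B
  singleton-⊆ s∈B i i∈s with ∈-singleton i∈s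
  ... | refl = s∈B

  ∈-remove⁻ : {A : Point n} {a i : Fin n} → T (remove A a i) → T (A i) × i ≢ a
  ∈-remove⁻ {A} {i = i} t with to (T-∧ {A i}) t
  ... | i∈A , i≢a = i∈A , toWitnessFalse i≢a

  ∈-remove⁺ : {A : Point n} {a i : Fin n} → T (A i) → i ≢ a → T (remove A a i)
  ∈-remove⁺ {A} {i = i} i∈A i≢a = from (T-∧ {A i}) (i∈A , fromWitnessFalse i≢a)

  remove-⊆ : {A : Point n} {a : Fin n} → remove A a ⊆ A
  remove-⊆ {A} i = proj₁ ∘ ∈-remove⁻ {A}

  remove-∪-singleton-⊆ : {A : Point n} {s : Fin n} → remove (A ∪ singleton s) s ⊆ A
  remove-∪-singleton-⊆ {A} i t with ∈-remove⁻ {A ∪ singleton _} t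
  ... | i∈A∪s , i≢s with to (T-∨ {A i}) i∈A∪s
  ...   | inj₁ i∈A = i∈A
  ...   | inj₂ i∈s = ⊥-elim (i≢s (∈-singleton i∈s))

  remove-∪-⊆ : {A S : Point n} {s a : Fin n} → T (S s) →
               remove (A ∪ singleton s) a ⊆ remove A a ∪ S
  remove-∪-⊆ {A} {S} s∈S i t with ∈-remove⁻ {A ∪ singleton _} t
  ... | i∈A∪s , i≢a with to (T-∨ {A i}) i∈A∪s
  ...   | inj₁ i∈A = ⊆-∪ˡ {remove A _} {S} i (∈-remove⁺ {A} i∈A i≢a)
  ...   | inj₂ i∈s = ⊆-∪ʳ {remove A _} {S} i (singleton-⊆ {S} s∈S i i∈s)

  agrees-on-⊆ : {B x : Point n} → B ⊆ x → ∀ i → T (B i) → B i ≡ x i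
  agrees-on-⊆ B⊆x i i∈B = trans (to T-≡ i∈B) (sym (to T-≡ (B⊆x i i∈B)))

  -- belowIn s S is definitionally below (toℕ s) S.
  below : ℕ → Point n → Point n
  below k S i = S i ∧ (toℕ i <ᵇ k)

  belowIn-⊆ : {S : Point n} {s : Fin n} → belowIn s S ⊆ S
  belowIn-⊆ {S} i = proj₁ ∘ to (T-∧ {S i})

  below-zero-⊆ : {S B : Point n} → below zero S ⊆ B
  below-zero-⊆ {S} i t with () ← proj₂ (to (T-∧ {S i}) t)

  below-suc-⊆-upToIn : {S : Point n} {j : Fin n} {k : ℕ} → toℕ j ≡ k →
                       below (suc k) S ⊆ upToIn j S
  below-suc-⊆-upToIn {S} refl i t with to (T-∧ {S i}) t
  ... | i∈S , i<1+j = from (T-∧ {S i}) (i∈S , ≤⇒≤ᵇ (m<1+n⇒m≤n (<ᵇ⇒< (toℕ i) _ i<1+j)))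

  below-suc-⊆-below : {S : Point n} {j : Fin n} {k : ℕ} → toℕ j ≡ k → ¬ T (S j) →
                      below (suc k) S ⊆ below k S
  below-suc-⊆-below {S} refl j∉S i t with to (T-∧ {S i}) t
  ... | i∈S , i<1+j with m<1+n⇒m<n∨m≡n (<ᵇ⇒< (toℕ i) _ i<1+j)
  ...   | inj₁ i<j = from (T-∧ {S i}) (i∈S , <⇒<ᵇ i<j)
  ...   | inj₂ i≡j with toℕ-injective i≡j
  ...     | refl = ⊥-elim (j∉S i∈S)

firstSuch-tabulate : ∀ {m n} (p : Fin n → Bool) (g : Fin m → Fin n) →
  (∀ j k → toℕ j < toℕ k → toℕ (g j) < toℕ (g k)) →
  ∀ {s} → firstSuch p (tabulate g) ≡ just s →
  p s ≡ true × (∀ j → toℕ (g j) < toℕ s → p (g j) ≡ false)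
firstSuch-tabulate {suc m} p g g-mono eq with p (g zero) in p₀
firstSuch-tabulate {suc m} p g g-mono refl | true =
  p₀ , λ { zero g₀<g₀ → ⊥-elim (<-irrefl refl g₀<g₀)
         ; (suc j) gⱼ<g₀ → ⊥-elim (<-irrefl refl (<-trans gⱼ<g₀ (g-mono zero (suc j) (s≤s z≤n)))) }
... | false with firstSuch-tabulate p (g ∘ suc) (λ j k → g-mono (suc j) (suc k) ∘ s≤s) eq
...   | ps , earlier = ps , λ { zero _ → p₀ ; (suc j) → earlier j }

firstSuch-allFin : ∀ {n} (p : Fin n → Bool) {s} → firstSuch p (allFin n) ≡ just s →
  p s ≡ true × (∀ j → toℕ j < toℕ s → p j ≡ false)
firstSuch-allFin p = firstSuch-tabulate p (λ j → j) (λ _ _ j<k → j<k)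

module _ {n : ℕ} {f : BoolFun n} where

  search-just : {A S : Point n} {s : Fin n} → search f A S ≡ just s →
    f A ≡ false × firstSuch (λ j → S j ∧ f (A ∪ upToIn j S)) (allFin n) ≡ just s
  search-just {A} {S} eq with f A | f (A ∪ S)
  ... | false | true = refl , eq

  search-∈ : {A S : Point n} {s : Fin n} → search f A S ≡ just s → T (S s)
  search-∈ {A} {S} {s} eq with S s | proj₁ (firstSuch-allFin _ (proj₂ (search-just eq)))
  ... | true | _ = _

  search-minimal : {A S : Point n} {s : Fin n} → search f A S ≡ just s →
    ∀ j → toℕ j < toℕ s → T (S j) → f (A ∪ upToIn j S) ≡ false
  search-minimal {A} {S} eq j j<s j∈S
    with S j | proj₂ (firstSuch-allFin _ (proj₂ (search-just eq))) j j<s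
  ... | true | fⱼ = fⱼ

  module _ (mono : Monotone f) where

    ⊆-mono : {A B : Point n} → A ⊆ B → f A ≤𝔹 f B
    ⊆-mono {A} {B} A⊆B = mono A B λ i → T⇒≤ (A⊆B i)
      where
      T⇒≤ : {a b : Bool} → (T a → T b) → a ≤𝔹 b
      T⇒≤ {false} {false} _ = b≤b
      T⇒≤ {false} {true} _ = f≤t
      T⇒≤ {true} {false} a⇒b = ⊥-elim (a⇒b _)
      T⇒≤ {true} {true} _ = b≤b

    ⊆-false : {A B : Point n} → A ⊆ B → f B ≡ false → f A ≡ false
    ⊆-false {A} A⊆B fB = ≤-antisym (subst (f A ≤𝔹_) fB (⊆-mono A⊆B)) (≤-minimum _)

    ⊆-true : {A B : Point n} → A ⊆ B → f A ≡ true → f B ≡ true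
    ⊆-true {B = B} A⊆B fA = ≤-antisym (≤-maximum _) (subst (_≤𝔹 f B) fA (⊆-mono A⊆B))

    below-false : {A S : Point n} → f A ≡ false →
      ∀ k → k ≤ n → (∀ j → toℕ j < k → T (S j) → f (A ∪ upToIn j S) ≡ false) →
      f (A ∪ below k S) ≡ false
    below-false fA zero _ _ = ⊆-false (∪-⊆ ⊆-refl below-zero-⊆) fA
    below-false {A} {S} fA (suc k) k<n earlier
      with T? (S (fromℕ< k<n)) | toℕ-fromℕ< k<n
    ... | yes j∈S | j≡k = ⊆-false (∪-mono-⊆ {A = A} ⊆-refl (below-suc-⊆-upToIn {S = S} j≡k))
                                  (earlier _ (s≤s (≤-reflexive j≡k)) j∈S)
    ... | no j∉S | j≡k = ⊆-false (∪-mono-⊆ {A = A} ⊆-refl (below-suc-⊆-below {S = S} j≡k j∉S))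
                                 (below-false fA k (<⇒≤ k<n) (λ i → earlier i ∘ m<n⇒m<1+n))

    search-belowIn-false : {A S : Point n} {s : Fin n} → search f A S ≡ just s →
                           f (A ∪ belowIn s S) ≡ false
    search-belowIn-false {s = s} eq =
      below-false (proj₁ (search-just eq)) (toℕ s) (<⇒≤ (toℕ<n s)) (search-minimal eq)

    record Invariant (xstar A S : Point n) : Set where
      field
        A⊆x⋆ : A ⊆ xstar
        S⊆x⋆ : S ⊆ xstar
        remove-∪-false : ∀ a → T (A a) → f (remove A a ∪ S) ≡ false
    open Invariant

    invariant-init : {xstar : Point n} → Invariant xstar ∅ xstar
    invariant-init = record { A⊆x⋆ = λ _ () ; S⊆x⋆ = ⊆-refl ; remove-∪-false = λ _ () }

    invariant-step : {xstar A S : Point n} {s : Fin n} → search f A S ≡ just s →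
      Invariant xstar A S → Invariant xstar (A ∪ singleton s) (belowIn s S)
    invariant-step {A = A} {S} {s} eq inv = record
      { A⊆x⋆ = ∪-⊆ (A⊆x⋆ inv) (singleton-⊆ (S⊆x⋆ inv s s∈S))
      ; S⊆x⋆ = ⊆-trans (belowIn-⊆ {S = S} {s}) (S⊆x⋆ inv)
      ; remove-∪-false = λ a a∈A′ → removal a (to (T-∨ {A a}) a∈A′)
      }
      where
      s∈S : T (S s)
      s∈S = search-∈ eq
      removal : ∀ a → T (A a) ⊎ T (singleton s a) → f (remove (A ∪ singleton s) a ∪ belowIn s S) ≡ false
      removal a (inj₁ a∈A) =
        ⊆-false (∪-⊆ (remove-∪-⊆ {A = A} s∈S)
                     (⊆-trans (belowIn-⊆ {S = S} {s}) (⊆-∪ʳ {A = remove A a})))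
                (remove-∪-false inv a a∈A)
      removal a (inj₂ a∈s) with ∈-singleton a∈s
      ... | refl = ⊆-false (∪-mono-⊆ (remove-∪-singleton-⊆ {A = A}) ⊆-refl)
                           (search-belowIn-false eq)

    certLoop-invariant : {xstar A S out : Point n} (fuel : ℕ) → Invariant xstar A S →
      certLoop f fuel A S ≡ just out → f out ≡ true × ∃ (Invariant xstar out)
    certLoop-invariant {A = A} fuel inv eq with f A in fA
    certLoop-invariant fuel inv refl | true = fA , _ , inv
    certLoop-invariant {A = A} {S} (suc fuel) inv eq | false with search f A S in found
    ... | just s = certLoop-invariant fuel (invariant-step found inv) eq

    IsCertificate-of-true : {x A : Point n} → f A ≡ true → A ⊆ x → IsCertificate f x A
    IsCertificate-of-true {x} {A} fA A⊆x y agree =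
      trans (⊆-true A⊆y fA) (sym (⊆-true A⊆x fA))
      where
      A⊆y : A ⊆ y
      A⊆y i i∈A = subst T (sym (agree i i∈A)) (A⊆x i i∈A)

¬IsCertificate-of-false : ∀ {n} {f : BoolFun n} {x B : Point n} →
  f x ≡ true → B ⊆ x → f B ≡ false → ¬ IsCertificate f x B
¬IsCertificate-of-false fx B⊆x fB cert
  with () ← trans (sym fB) (trans (cert _ (agrees-on-⊆ B⊆x)) fx)

lemma3p3 : ∀ (n : ℕ) (f : BoolFun n) (xstar : Point n) (A : Point n) →
    Monotone f → f xstar ≡ true → CertOutputs f xstar A →
    IsMinimalCertificate f xstar A
lemma3p3 n f xstar A mono fx (fuel , run)
  with certLoop-invariant mono fuel (invariant-init mono) run
... | fA , _ , inv = IsCertificate-of-true mono fA A⊆x⋆ , minimal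
  where
  open Invariant inv
  minimal : ∀ a → T (A a) → ¬ IsCertificate f xstar (remove A a)
  minimal a a∈A = ¬IsCertificate-of-false fx (⊆-trans remove-⊆ A⊆x⋆)
                    (⊆-false mono ⊆-∪ˡ (remove-∪-false a a∈A))
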